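{- Let $Q=(q_k)_{k\ge1}$ be a sequence of integers with $q_k>1$, let $\varepsilon_k\in\{0,1,\dots,q_k-1\}$ for all $k$, and let $x=\sum_{k=1}^\infty\frac{\varepsilon_k}{q_1q_2\cdots q_k}$; for $n\ge0$ put $\sigma^n(x)=\sum_{k=n+1}^\infty\frac{\varepsilon_k}{q_{n+1}\cdots q_k}$. Let $n_0$ be a fixed positive integer, let $q_0=\min_{n>n_0}q_n$, let $k\ge1$ be such that $q_{n_0+k}=q_0$, and let $\varepsilon_0=\varepsilon_{n_0+k}$. Then $\sigma^n(x)$ takes the same value for all $n\ge n_0$ if and only if $\varepsilon_n=\frac{q_n-1}{q_0-1}\varepsilon_0$ (in particular this is a nonnegative integer) for every $n>n_0$. -}

module Defs where

open import Data.Nat using (ℕ; zero; suc; _+_; _*_; _≤_)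
open import Data.Integer using (+_)
open import Data.Rational.Unnormalised using (ℚᵘ; mkℚᵘ; 0ℚᵘ; _-_; ∣_∣)
  renaming (_+_ to _+ᵘ_; _≤_ to _≤ᵘ_)
open import Data.Product using (∃)

-- a / b as an (unnormalised) rational; for b = 0 a junk value 0 is returned.
-- (Only ever used with b a product of the q_j, which are > 1 under the hypotheses.)
frac : ℕ → ℕ → ℚᵘ
frac a zero    = 0ℚᵘ
frac a (suc b) = mkℚᵘ (+ a) b

prodQ : (ℕ → ℕ) → ℕ → ℕ → ℕ
prodQ q n zero    = 1
prodQ q n (suc d) = prodQ q n d * q (n + suc d)

-- tailSum q ε n d = Σ_{i=1}^{d} ε_{n+i} / (q_{n+1} ⋯ q_{n+i})
-- = the d-th partial sum of the series defining σ^n(x).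
tailSum : (ℕ → ℕ) → (ℕ → ℕ) → ℕ → ℕ → ℚᵘ
tailSum q ε n zero    = 0ℚᵘ
tailSum q ε n (suc d) = tailSum q ε n d +ᵘ frac (ε (n + suc d)) (prodQ q n (suc d))

-- σ^n(x) = σ^m(x) as real numbers: the real numbers are the (Cauchy) sequences
-- of partial sums, and two such are equal iff their difference tends to 0.
SigmaEq : (ℕ → ℕ) → (ℕ → ℕ) → ℕ → ℕ → Set
SigmaEq q ε n m =
  (j : ℕ) → ∃ λ M → (d : ℕ) → M ≤ d →
    ∣ tailSum q ε n d - tailSum q ε m d ∣ ≤ᵘ mkℚᵘ (+ 1) j

{-# OPTIONS --safe #-}
-- Writing σⁿ for the n-th tail sum, q_{n+1} σⁿ = ε_{n+1} + σⁿ⁺¹.  If all tails beyond n₀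
-- coincide with a value s, this forces ε_n = (q_n − 1) s for every n > n₀, and eliminating s
-- between n and n₀ + k gives the proportionality.  Conversely, with b = q₀ − 1 and a = ε₀ the
-- proportionality keeps b N + a = a P for the numerators N and denominators P of the partial
-- sums, so they lie within 1/P of a / b and every tail converges to a / b.
module Submission where

open import Defs
open import Data.Nat using (ℕ; zero; suc; _+_; _*_; _∸_; _≤_; _<_; z≤n; s≤s; _⊔_)
import Data.Nat.Properties as ℕ
open import Data.Nat.Tactic.RingSolver using (solve-∀)
open import Data.Integer as ℤ using (+_; +≤+)
import Data.Integer.Properties as ℤₚ
open import Data.Rational.Unnormalised as ℚ using (ℚᵘ; mkℚᵘ; 0ℚᵘ; *≡*; *≤*; _≃_; ∣_∣; -_)
import Data.Rational.Unnormalised.Properties as ℚₚ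
open import Data.Rational.Unnormalised.Solver using (module +-*-Solver)
open +-*-Solver using (solve; con; _:+_; _:-_; :-_; _:*_; _:=_)
open import Data.Product using (∃; _,_; proj₂)
open import Data.Sum using (inj₁; inj₂)
open import Function using (_∘_; const)
open import Function.Bundles using (_⇔_; mk⇔)
open import Level using (0ℓ)
open import Relation.Binary.Bundles using (Setoid)
open import Relation.Binary.Structures using (IsEquivalence)
open import Relation.Binary.PropositionalEquality
import Relation.Binary.Reasoning.Setoid as SetoidReasoning

fromℕ : ℕ → ℚᵘ
fromℕ c = frac c 1

1/[1+_] : ℕ → ℚᵘ
1/[1+ j ] = frac 1 (suc j)

*-≡⇒frac-≃ : ∀ {a P c R} → 1 ≤ P → 1 ≤ R → a * R ≡ c * P → frac a P ≃ frac c R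
*-≡⇒frac-≃ {a} {suc P} {c} {suc R} _ _ eq =
  *≡* (trans (sym (ℤₚ.pos-* a (suc R))) (trans (cong +_ eq) (ℤₚ.pos-* c (suc P))))

*-≤⇒frac-≤ : ∀ {a P c R} → 1 ≤ P → 1 ≤ R → a * R ≤ c * P → frac a P ℚ.≤ frac c R
*-≤⇒frac-≤ {a} {suc P} {c} {suc R} _ _ le =
  *≤* (subst₂ ℤ._≤_ (ℤₚ.pos-* a (suc R)) (ℤₚ.pos-* c (suc P)) (+≤+ le))

frac-≤⇒*-≤ : ∀ {a P c R} → 1 ≤ P → 1 ≤ R → frac a P ℚ.≤ frac c R → a * R ≤ c * P
frac-≤⇒*-≤ {a} {suc P} {c} {suc R} _ _ (*≤* le) =
  ℤₚ.drop‿+≤+ (subst₂ ℤ._≤_ (sym (ℤₚ.pos-* a (suc R))) (sym (ℤₚ.pos-* c (suc P))) le)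

frac-+ : ∀ {a P c R} → 1 ≤ P → 1 ≤ R → frac a P ℚ.+ frac c R ≃ frac (a * R + c * P) (P * R)
frac-+ {a} {suc P} {c} {suc R} _ _ = ℚₚ.≃-reflexive (cong (λ z → mkℚᵘ z (R + P * suc R))
  (cong₂ ℤ._+_ (sym (ℤₚ.pos-* a (suc R))) (sym (ℤₚ.pos-* c (suc P)))))

frac-* : ∀ {a P c R} → 1 ≤ P → 1 ≤ R → frac a P ℚ.* frac c R ≃ frac (a * c) (P * R)
frac-* {a} {suc P} {c} {suc R} _ _ =
  ℚₚ.≃-reflexive (cong (λ z → mkℚᵘ z (R + P * suc R)) (sym (ℤₚ.pos-* a c)))

frac-+-sameDenominator : ∀ {a c P} → 1 ≤ P → frac a P ℚ.+ frac c P ≃ frac (a + c) P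
frac-+-sameDenominator {a} {c} {P} P≥1 = ℚₚ.≃-trans (frac-+ P≥1 P≥1)
  (*-≡⇒frac-≃ (ℕ.*-mono-≤ P≥1 P≥1) P≥1 (lemma a c P))
  where
  lemma : ∀ a c P → (a * P + c * P) * P ≡ (a + c) * (P * P)
  lemma = solve-∀

0≤frac : ∀ a P → 0ℚᵘ ℚ.≤ frac a P
0≤frac a zero    = ℚₚ.≤-refl
0≤frac a (suc P) = ℚₚ.nonNegative⁻¹ (frac a (suc P))

fromℕ-* : ∀ m n → fromℕ (m * n) ≃ fromℕ m ℚ.* fromℕ n
fromℕ-* m n = ℚₚ.≃-sym (frac-* {m} {1} {n} {1} (s≤s z≤n) (s≤s z≤n))

1/[1+]-antimono : ∀ {j d} → j ≤ d → 1/[1+ d ] ℚ.≤ 1/[1+ j ]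
1/[1+]-antimono j≤d = *-≤⇒frac-≤ (s≤s z≤n) (s≤s z≤n) (ℕ.*-monoʳ-≤ 1 (s≤s j≤d))

p≤∣p∣ : ∀ p → p ℚ.≤ ∣ p ∣
p≤∣p∣ (mkℚᵘ (+ n)      d) = ℚₚ.≤-refl
p≤∣p∣ (mkℚᵘ ℤ.-[1+ n ] d) = ℚₚ.<⇒≤ (ℚₚ.neg<pos (mkℚᵘ ℤ.-[1+ n ] d) (mkℚᵘ (+ suc n) d))

p≤q+r⇒p-q≤r : ∀ {p q r} → p ℚ.≤ q ℚ.+ r → p ℚ.- q ℚ.≤ r
p≤q+r⇒p-q≤r {p} {q} {r} le =
  ℚₚ.≤-respʳ-≃ (solve 2 (λ q r → (q :+ r) :- q := r) ℚₚ.≃-refl q r) (ℚₚ.+-monoˡ-≤ (- q) le)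

∣p-q∣≃∣q-p∣ : ∀ p q → ∣ p ℚ.- q ∣ ≃ ∣ q ℚ.- p ∣
∣p-q∣≃∣q-p∣ p q = ℚₚ.≃-trans
  (ℚₚ.∣-∣-cong (solve 2 (λ p q → p :- q := :- (q :- p)) ℚₚ.≃-refl p q))
  (ℚₚ.∣-p∣≃∣p∣ (q ℚ.- p))

p≤q+r∧q≤p+r⇒∣p-q∣≤r : ∀ {p q r} → p ℚ.≤ q ℚ.+ r → q ℚ.≤ p ℚ.+ r →
                       ∣ p ℚ.- q ∣ ℚ.≤ r
p≤q+r∧q≤p+r⇒∣p-q∣≤r {p} {q} p≤q+r q≤p+r with ℚₚ.∣p∣≡p∨∣p∣≡-p (p ℚ.- q)
... | inj₁ ∣p-q∣≡p-q = subst (ℚ._≤ _) (sym ∣p-q∣≡p-q) (p≤q+r⇒p-q≤r p≤q+r)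
... | inj₂ ∣p-q∣≡q-p = subst (ℚ._≤ _) (sym ∣p-q∣≡q-p)
  (ℚₚ.≤-respˡ-≃ (solve 2 (λ p q → q :- p := :- (p :- q)) ℚₚ.≃-refl p q) (p≤q+r⇒p-q≤r q≤p+r))

∣p-q∣≤r⇒q≤p+r : ∀ {p q r} → ∣ p ℚ.- q ∣ ℚ.≤ r → q ℚ.≤ p ℚ.+ r
∣p-q∣≤r⇒q≤p+r {p} {q} {r} le =
  ℚₚ.≤-respˡ-≃ (solve 2 (λ p q → p :+ (q :- p) := q) ℚₚ.≃-refl p q)
    (ℚₚ.+-monoʳ-≤ p (ℚₚ.≤-trans (p≤∣p∣ (q ℚ.- p))
                                 (ℚₚ.≤-respˡ-≃ (∣p-q∣≃∣q-p∣ p q) le)))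

∣N/P-a/b∣≤1/[1+d] : ∀ {N P a b d} → 1 ≤ b → a ≤ b → suc d ≤ P → b * N + a ≡ a * P →
                    ∣ frac N P ℚ.- frac a b ∣ ℚ.≤ 1/[1+ d ]
∣N/P-a/b∣≤1/[1+d] {N} {P} {a} {b} {d} b≥1 a≤b d<P invariant =
  p≤q+r∧q≤p+r⇒∣p-q∣≤r
    (ℚₚ.≤-trans (*-≤⇒frac-≤ P≥1 b≥1 N*b≤a*P) (ℚₚ.p≤p+q (frac a b) 1/[1+ d ]))
    (ℚₚ.≤-trans (*-≤⇒frac-≤ b≥1 P≥1 a*P≤[N+1]*b)
      (ℚₚ.≤-respˡ-≃ (frac-+-sameDenominator P≥1) (ℚₚ.+-monoʳ-≤ (frac N P) 1/P≤1/[1+d])))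
  where
  open ℕ.≤-Reasoning
  P≥1 : 1 ≤ P
  P≥1 = ℕ.≤-trans (s≤s z≤n) d<P
  N*b≤a*P : N * b ≤ a * P
  N*b≤a*P = begin
    N * b     ≡⟨ ℕ.*-comm N b ⟩
    b * N     ≤⟨ ℕ.m≤m+n (b * N) a ⟩
    b * N + a ≡⟨ invariant ⟩
    a * P     ∎
  distrib : ∀ b N → b * N + b ≡ (N + 1) * b
  distrib = solve-∀
  a*P≤[N+1]*b : a * P ≤ (N + 1) * b
  a*P≤[N+1]*b = begin
    a * P       ≡⟨ invariant ⟨
    b * N + a   ≤⟨ ℕ.+-monoʳ-≤ (b * N) a≤b ⟩
    b * N + b   ≡⟨ distrib b N ⟩
    (N + 1) * b ∎
  1/P≤1/[1+d] : frac 1 P ℚ.≤ 1/[1+ d ]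
  1/P≤1/[1+d] = *-≤⇒frac-≤ P≥1 (s≤s z≤n) (ℕ.*-monoʳ-≤ 1 d<P)

Seq : Set
Seq = ℕ → ℚᵘ

infixl 6 _+ₛ_
infixr 7 _·ₛ_
infix  4 _∼_

_+ₛ_ : Seq → Seq → Seq
(a +ₛ b) d = a d ℚ.+ b d

_·ₛ_ : ℕ → Seq → Seq
(k ·ₛ a) d = fromℕ k ℚ.* a d

-- The body of SigmaEq, made a record so that the two sequences can be inferred from a proof.
record _∼_ (a b : Seq) : Set where
  constructor mk∼
  field
    eventually-close : (j : ℕ) → ∃ λ M → (d : ℕ) → M ≤ d → ∣ a d ℚ.- b d ∣ ℚ.≤ 1/[1+ j ]
open _∼_

≃⇒∼ : ∀ {a b} → (∀ d → a d ≃ b d) → a ∼ b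
≃⇒∼ {a} {b} a≃b = mk∼ λ j → 0 , λ d _ →
  ℚₚ.≤-respˡ-≃ (ℚₚ.≃-sym (ℚₚ.∣-∣-cong (ℚₚ.p≃q⇒p-q≃0 (a d) (b d) (a≃b d))))
    (0≤frac 1 (suc j))

∼-from-bound : ∀ {a b} → (∀ d → ∣ a d ℚ.- b d ∣ ℚ.≤ 1/[1+ d ]) → a ∼ b
∼-from-bound bound = mk∼ λ j → j , λ d j≤d → ℚₚ.≤-trans (bound d) (1/[1+]-antimono j≤d)

∼-sym : ∀ {a b} → a ∼ b → b ∼ a
∼-sym {a} {b} (mk∼ a∼b) = mk∼ λ j → let (M , bound) = a∼b j in
  M , λ d M≤d → ℚₚ.≤-respˡ-≃ (∣p-q∣≃∣q-p∣ (a d) (b d)) (bound d M≤d)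

1/[1+2j+1]+1/[1+2j+1]≤1/[1+j] : ∀ j → 1/[1+ suc (2 * j) ] ℚ.+ 1/[1+ suc (2 * j) ] ℚ.≤ 1/[1+ j ]
1/[1+2j+1]+1/[1+2j+1]≤1/[1+j] j =
  ℚₚ.≤-respˡ-≃ (ℚₚ.≃-sym (frac-+ {1} {2 + 2 * j} {1} {2 + 2 * j} (s≤s z≤n) (s≤s z≤n)))
    (*-≤⇒frac-≤ {P = (2 + 2 * j) * (2 + 2 * j)} (s≤s z≤n) (s≤s z≤n) (ℕ.≤-reflexive (lemma j)))
  where
  lemma : ∀ j → (1 * (2 + 2 * j) + 1 * (2 + 2 * j)) * suc j ≡ 1 * ((2 + 2 * j) * (2 + 2 * j))
  lemma = solve-∀

∼-trans : ∀ {a b c} → a ∼ b → b ∼ c → a ∼ c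
∼-trans {a} {b} {c} (mk∼ a∼b) (mk∼ b∼c) = mk∼ λ j →
  let (M₁ , bound₁) = a∼b (suc (2 * j)) ; (M₂ , bound₂) = b∼c (suc (2 * j)) in
  M₁ ⊔ M₂ , λ d M≤d →
  ℚₚ.≤-respˡ-≃ (ℚₚ.∣-∣-cong (ℚₚ.+-minus-telescope (a d) (b d) (c d)))
    (ℚₚ.≤-trans (ℚₚ.∣p+q∣≤∣p∣+∣q∣ (a d ℚ.- b d) (b d ℚ.- c d))
      (ℚₚ.≤-trans (ℚₚ.+-mono-≤ (bound₁ d (ℕ.≤-trans (ℕ.m≤m⊔n M₁ M₂) M≤d))
                               (bound₂ d (ℕ.≤-trans (ℕ.m≤n⊔m M₁ M₂) M≤d)))
        (1/[1+2j+1]+1/[1+2j+1]≤1/[1+j] j)))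

∼-isEquivalence : IsEquivalence _∼_
∼-isEquivalence = record { refl = ≃⇒∼ (λ _ → ℚₚ.≃-refl) ; sym = ∼-sym ; trans = ∼-trans }

∼-setoid : Setoid 0ℓ 0ℓ
∼-setoid = record { isEquivalence = ∼-isEquivalence }

∼-cancelʳ-+ : ∀ {a b c} → a +ₛ c ∼ b +ₛ c → a ∼ b
∼-cancelʳ-+ {a} {b} {c} (mk∼ a+c∼b+c) = mk∼ λ j → let (M , bound) = a+c∼b+c j in
  M , λ d M≤d → ℚₚ.≤-respˡ-≃ (ℚₚ.∣-∣-cong (cancel (a d) (b d) (c d))) (bound d M≤d)
  where
  cancel : ∀ x y z → (x ℚ.+ z) ℚ.- (y ℚ.+ z) ≃ x ℚ.- y
  cancel = solve 3 (λ x y z → (x :+ z) :- (y :+ z) := x :- y) ℚₚ.≃-refl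

k*1/[1+k*[1+j]]≤1/[1+j] : ∀ k j → fromℕ k ℚ.* 1/[1+ k * suc j ] ℚ.≤ 1/[1+ j ]
k*1/[1+k*[1+j]]≤1/[1+j] k j =
  ℚₚ.≤-respˡ-≃ (ℚₚ.≃-sym (frac-* {k} {1} {1} {suc (k * suc j)} (s≤s z≤n) (s≤s z≤n)))
    (*-≤⇒frac-≤ (s≤s z≤n) (s≤s z≤n) (subst₂ _≤_ (lhs k j) (rhs k j) (ℕ.n≤1+n (k * suc j))))
  where
  lhs : ∀ k j → k * suc j ≡ k * 1 * suc j
  lhs = solve-∀
  rhs : ∀ k j → suc (k * suc j) ≡ 1 * (1 * suc (k * suc j))
  rhs = solve-∀

∼-scale : ∀ k {a b} → a ∼ b → k ·ₛ a ∼ k ·ₛ b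
∼-scale k {a} {b} (mk∼ a∼b) = mk∼ λ j → let (M , bound) = a∼b (k * suc j) in
  M , λ d M≤d → ℚₚ.≤-respˡ-≃ (ℚₚ.≃-sym (∣k*x-k*y∣≃k*∣x-y∣ (a d) (b d)))
    (ℚₚ.≤-trans (ℚₚ.*-monoʳ-≤-nonNeg (fromℕ k) (bound d M≤d)) (k*1/[1+k*[1+j]]≤1/[1+j] k j))
  where
  ∣k*x-k*y∣≃k*∣x-y∣ : ∀ x y →
                      ∣ fromℕ k ℚ.* x ℚ.- fromℕ k ℚ.* y ∣ ≃ fromℕ k ℚ.* ∣ x ℚ.- y ∣
  ∣k*x-k*y∣≃k*∣x-y∣ x y = ℚₚ.≃-trans
    (ℚₚ.∣-∣-cong (solve 3 (λ k x y → k :* x :- k :* y := k :* (x :- y)) ℚₚ.≃-refl (fromℕ k) x y))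
    (ℚₚ.∣p*q∣≃∣p∣*∣q∣ (fromℕ k) (x ℚ.- y))

∣m-n∣≤1/2⇒n≤m : ∀ m n → ∣ fromℕ m ℚ.- fromℕ n ∣ ℚ.≤ 1/[1+ 1 ] → n ≤ m
∣m-n∣≤1/2⇒n≤m m n close = ℕ.<⇒≤pred (ℕ.*-cancelʳ-< 2 n (suc m) (begin-strict
  n * 2               ≤⟨ frac-≤⇒*-≤ {n} {1} (s≤s z≤n) (s≤s z≤n) n≤m+1/2 ⟩
  (m * 2 + 1 * 1) * 1 ≡⟨ lemma m ⟩
  suc (m * 2)         <⟨ ℕ.n<1+n (suc (m * 2)) ⟩
  suc m * 2           ∎))
  where
  open ℕ.≤-Reasoning
  n≤m+1/2 : fromℕ n ℚ.≤ frac (m * 2 + 1 * 1) 2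
  n≤m+1/2 = ℚₚ.≤-respʳ-≃ (frac-+ {m} {1} {1} {2} (s≤s z≤n) (s≤s z≤n))
    (∣p-q∣≤r⇒q≤p+r {fromℕ m} {fromℕ n} close)
  lemma : ∀ m → (m * 2 + 1 * 1) * 1 ≡ suc (m * 2)
  lemma = solve-∀

const-injective : ∀ m n → const (fromℕ m) ∼ const (fromℕ n) → m ≡ n
const-injective m n m∼n = ℕ.≤-antisym
  (∣m-n∣≤1/2⇒n≤m n m (proj₂ (eventually-close (∼-sym m∼n) 1) _ ℕ.≤-refl))
  (∣m-n∣≤1/2⇒n≤m m n (proj₂ (eventually-close m∼n 1) _ ℕ.≤-refl))

∼-proportional : ∀ {Y} a b c e → const (fromℕ a) ∼ c ·ₛ Y → const (fromℕ b) ∼ e ·ₛ Y →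
                 e * a ≡ c * b
∼-proportional {Y} a b c e a∼cY b∼eY = const-injective (e * a) (c * b) (begin
  const (fromℕ (e * a))  ≈⟨ ≃⇒∼ (λ _ → fromℕ-* e a) ⟩
  e ·ₛ const (fromℕ a)   ≈⟨ ∼-scale e a∼cY ⟩
  e ·ₛ c ·ₛ Y            ≈⟨ ≃⇒∼ (λ d → swap (fromℕ e) (fromℕ c) (Y d)) ⟩
  c ·ₛ e ·ₛ Y            ≈⟨ ∼-scale c (∼-sym b∼eY) ⟩
  c ·ₛ const (fromℕ b)   ≈⟨ ≃⇒∼ (λ _ → ℚₚ.≃-sym (fromℕ-* c b)) ⟩
  const (fromℕ (c * b))  ∎)
  where
  open SetoidReasoning ∼-setoid
  swap : ∀ x y z → x ℚ.* (y ℚ.* z) ≃ y ℚ.* (x ℚ.* z)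
  swap = solve 3 (λ x y z → x :* (y :* z) := y :* (x :* z)) ℚₚ.≃-refl

invariant-step : ∀ {a b N P Q e} → 1 ≤ Q → b * e ≡ (Q ∸ 1) * a → b * N + a ≡ a * P →
                 b * (N * Q + e) + a ≡ a * (P * Q)
invariant-step {a} {b} {N} {P} {suc s} {e} _ b*e≡s*a invariant = begin
  b * (N * suc s + e) + a   ≡⟨ expand₁ b N s e a ⟩
  b * N * suc s + (b * e + a) ≡⟨ cong (λ t → b * N * suc s + (t + a)) b*e≡s*a ⟩
  b * N * suc s + (s * a + a) ≡⟨ expand₂ b N s a ⟩
  (b * N + a) * suc s       ≡⟨ cong (_* suc s) invariant ⟩
  a * P * suc s             ≡⟨ ℕ.*-assoc a P (suc s) ⟩
  a * (P * suc s)           ∎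
  where
  open ≡-Reasoning
  expand₁ : ∀ b N s e a → b * (N * suc s + e) + a ≡ b * N * suc s + (b * e + a)
  expand₁ = solve-∀
  expand₂ : ∀ b N s a → b * N * suc s + (s * a + a) ≡ (b * N + a) * suc s
  expand₂ = solve-∀

module Expansion (q ε : ℕ → ℕ)
                 (q>1 : ∀ k → 1 ≤ k → 1 < q k) (ε<q : ∀ k → 1 ≤ k → ε k < q k) where

  σ : ℕ → Seq
  σ = tailSum q ε

  P : ℕ → ℕ → ℕ
  P = prodQ q

  N : ℕ → ℕ → ℕ
  N n zero    = 0
  N n (suc d) = N n d * q (n + suc d) + ε (n + suc d)

  1≤n+suc[d] : ∀ n d → 1 ≤ n + suc d
  1≤n+suc[d] n d = ℕ.≤-trans (s≤s z≤n) (ℕ.m≤n+m (suc d) n)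

  1≤q : ∀ n d → 1 ≤ q (n + suc d)
  1≤q n d = ℕ.<⇒≤ (q>1 _ (1≤n+suc[d] n d))

  P-pos : ∀ n d → 1 ≤ P n d
  P-pos n zero    = s≤s z≤n
  P-pos n (suc d) = ℕ.*-mono-≤ (P-pos n d) (1≤q n d)

  d<P : ∀ n d → d < P n d
  d<P n zero    = s≤s z≤n
  d<P n (suc d) = ℕ.≤-trans (s≤s (d<P n d)) (1+m≤m*n (P-pos n d) (q>1 _ (1≤n+suc[d] n d)))
    where
    1+m≤m*n : ∀ {m n} → 1 ≤ m → 2 ≤ n → suc m ≤ m * n
    1+m≤m*n {suc m} _ 2≤n = ℕ.≤-trans (s≤s (s≤s (ℕ.m≤m*n m 2))) (ℕ.*-monoʳ-≤ (suc m) 2≤n)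

  σ≃N/P : ∀ n d → σ n d ≃ frac (N n d) (P n d)
  σ≃N/P n zero    = ℚₚ.≃-refl
  σ≃N/P n (suc d) = begin
    σ n d ℚ.+ frac e (Pd * qd)               ≈⟨ ℚₚ.+-congˡ (frac e (Pd * qd)) (σ≃N/P n d) ⟩
    frac Nd Pd ℚ.+ frac e (Pd * qd)          ≈⟨ frac-+ (P-pos n d) (P-pos n (suc d)) ⟩
    frac (Nd * (Pd * qd) + e * Pd) (Pd * (Pd * qd))
      ≈⟨ *-≡⇒frac-≃ (ℕ.*-mono-≤ (P-pos n d) (P-pos n (suc d))) (P-pos n (suc d))
                    (lemma Nd Pd qd e) ⟩
    frac (Nd * qd + e) (Pd * qd)             ∎
    where
    open ℚₚ.≃-Reasoning
    Nd = N n d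
    Pd = P n d
    qd = q (n + suc d)
    e = ε (n + suc d)
    lemma : ∀ N P q e → (N * (P * q) + e * P) * (P * q) ≡ (N * q + e) * (P * (P * q))
    lemma = solve-∀

  P-suc : ∀ n d → P n (suc d) ≡ q (suc n) * P (suc n) d
  P-suc n zero    = trans (ℕ.*-identityˡ _) (trans (cong q (ℕ.+-comm n 1)) (sym (ℕ.*-identityʳ _)))
  P-suc n (suc d) = trans (cong₂ _*_ (P-suc n d) (cong q (ℕ.+-suc n (suc d))))
                          (ℕ.*-assoc (q (suc n)) (P (suc n) d) (q (suc n + suc d)))

  N-suc : ∀ n d → N n (suc d) ≡ ε (suc n) * P (suc n) d + N (suc n) d
  N-suc n zero    = trans (cong ε (ℕ.+-comm n 1)) (sym (trans (ℕ.+-identityʳ _) (ℕ.*-identityʳ _)))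
  N-suc n (suc d) = trans (cong₂ (λ u i → u * q i + ε i) (N-suc n d) (ℕ.+-suc n (suc d)))
                          (lemma (ε (suc n)) (P (suc n) d) (N (suc n) d) (q m) (ε m))
    where
    m = suc n + suc d
    lemma : ∀ a b c x y → (a * b + c) * x + y ≡ a * (b * x) + (c * x + y)
    lemma = solve-∀

  σ-shift : ∀ n d → fromℕ (q (suc n)) ℚ.* σ n (suc d) ≃ fromℕ (ε (suc n)) ℚ.+ σ (suc n) d
  σ-shift n d = begin
    fromℕ q' ℚ.* σ n (suc d)                ≈⟨ ℚₚ.*-congˡ {fromℕ q'} (σ≃N/P n (suc d)) ⟩
    fromℕ q' ℚ.* frac (N n (suc d)) (P n (suc d))
      ≈⟨ frac-* (s≤s z≤n) (P-pos n (suc d)) ⟩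
    frac (q' * N n (suc d)) (1 * P n (suc d))
      ≈⟨ *-≡⇒frac-≃ (1*-pos (P-pos n (suc d))) (1*-pos (P-pos (suc n) d)) cross ⟩
    frac (e' * P' + N' * 1) (1 * P')          ≈⟨ frac-+ (s≤s z≤n) (P-pos (suc n) d) ⟨
    fromℕ e' ℚ.+ frac N' P'                   ≈⟨ ℚₚ.+-congʳ (fromℕ e') (σ≃N/P (suc n) d) ⟨
    fromℕ e' ℚ.+ σ (suc n) d                  ∎
    where
    open ℚₚ.≃-Reasoning
    q' = q (suc n)
    e' = ε (suc n)
    P' = P (suc n) d
    N' = N (suc n) d
    1*-pos : ∀ {m} → 1 ≤ m → 1 ≤ 1 * m
    1*-pos {m} = subst (1 ≤_) (sym (ℕ.*-identityˡ m))
    lemma : ∀ q e P N → q * (e * P + N) * (1 * P) ≡ (e * P + N * 1) * (1 * (q * P))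
    lemma = solve-∀
    cross : q' * N n (suc d) * (1 * P') ≡ (e' * P' + N' * 1) * (1 * P n (suc d))
    cross rewrite N-suc n d | P-suc n d = lemma q' e' P' N'

  σ∘suc∼σ : ∀ n → σ n ∘ suc ∼ σ n
  σ∘suc∼σ n = ∼-from-bound λ d →
    ℚₚ.≤-respˡ-≃ (ℚₚ.≃-sym (∣σ[1+d]-σ[d]∣≃term d)) (term≤ d)
    where
    term : ℕ → ℚᵘ
    term d = frac (ε (n + suc d)) (P n (suc d))
    cancel : ∀ s t → (s ℚ.+ t) ℚ.- s ≃ t
    cancel = solve 2 (λ s t → (s :+ t) :- s := t) ℚₚ.≃-refl
    ∣σ[1+d]-σ[d]∣≃term : ∀ d → ∣ σ n (suc d) ℚ.- σ n d ∣ ≃ term d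
    ∣σ[1+d]-σ[d]∣≃term d = ℚₚ.≃-trans (ℚₚ.∣-∣-cong (cancel (σ n d) (term d)))
      (ℚₚ.0≤p⇒∣p∣≃p (0≤frac (ε (n + suc d)) (P n (suc d))))
    term≤ : ∀ d → term d ℚ.≤ 1/[1+ d ]
    term≤ d = *-≤⇒frac-≤ {ε (n + suc d)} {P n (suc d)} (P-pos n (suc d)) (s≤s z≤n) (begin
      ε (n + suc d) * suc d        ≤⟨ ℕ.*-mono-≤ (ℕ.<⇒≤ (ε<q _ (1≤n+suc[d] n d))) (d<P n d) ⟩
      q (n + suc d) * P n d        ≡⟨ ℕ.*-comm (q (n + suc d)) (P n d) ⟩
      P n (suc d)                  ≡⟨ ℕ.*-identityˡ (P n (suc d)) ⟨
      1 * P n (suc d)              ∎)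
      where open ℕ.≤-Reasoning

  ε∼[q-1]σ : ∀ n → σ n ∼ σ (suc n) →
             const (fromℕ (ε (suc n))) ∼ (q (suc n) ∸ 1) ·ₛ σ (suc n)
  ε∼[q-1]σ n σₙ∼σₙ₊₁ = ∼-cancelʳ-+ (begin
    const (fromℕ (ε (suc n))) +ₛ σ (suc n)   ≈⟨ ≃⇒∼ (λ d → ℚₚ.≃-sym (σ-shift n d)) ⟩
    q (suc n) ·ₛ (σ n ∘ suc)
      ≈⟨ ∼-scale (q (suc n)) (∼-trans (σ∘suc∼σ n) σₙ∼σₙ₊₁) ⟩
    q (suc n) ·ₛ σ (suc n)                   ≈⟨ ≃⇒∼ (λ d → split (σ (suc n) d)) ⟩
    (q (suc n) ∸ 1) ·ₛ σ (suc n) +ₛ σ (suc n) ∎)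
    where
    open SetoidReasoning ∼-setoid
    q≡[q-1]+1 : q (suc n) ≡ (q (suc n) ∸ 1) + 1
    q≡[q-1]+1 = sym (ℕ.m∸n+n≡m (ℕ.<⇒≤ (q>1 (suc n) (s≤s z≤n))))
    q≃[q-1]+1 : fromℕ (q (suc n)) ≃ fromℕ (q (suc n) ∸ 1) ℚ.+ fromℕ 1
    q≃[q-1]+1 = ℚₚ.≃-trans (ℚₚ.≃-reflexive (cong fromℕ q≡[q-1]+1))
      (ℚₚ.≃-sym (frac-+-sameDenominator {q (suc n) ∸ 1} {1} (s≤s z≤n)))
    split : ∀ x → fromℕ (q (suc n)) ℚ.* x ≃ fromℕ (q (suc n) ∸ 1) ℚ.* x ℚ.+ x
    split x = ℚₚ.≃-trans (ℚₚ.*-congʳ {x} q≃[q-1]+1)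
      (solve 2 (λ a x → (a :+ con (fromℕ 1)) :* x := a :* x :+ x) ℚₚ.≃-refl (fromℕ (q (suc n) ∸ 1)) x)

  N-invariant : ∀ n {a b} → (∀ i → n < i → b * ε i ≡ (q i ∸ 1) * a) →
                ∀ d → b * N n d + a ≡ a * P n d
  N-invariant n {a} {b} proportional zero    =
    trans (cong (_+ a) (ℕ.*-zeroʳ b)) (sym (ℕ.*-identityʳ a))
  N-invariant n {a} {b} proportional (suc d) = invariant-step {a} {b} (1≤q n d)
    (proportional (n + suc d) (ℕ.m<m+n n (s≤s z≤n)))
    (N-invariant n {a} {b} proportional d)

  σ∼a/b : ∀ n {a b} → 1 ≤ b → a ≤ b → (∀ i → n < i → b * ε i ≡ (q i ∸ 1) * a) →
          σ n ∼ const (frac a b)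
  σ∼a/b n {a} {b} b≥1 a≤b proportional = ∼-from-bound λ d →
    ℚₚ.≤-respˡ-≃ (ℚₚ.∣-∣-cong (ℚₚ.+-congˡ _ (ℚₚ.≃-sym (σ≃N/P n d))))
      (∣N/P-a/b∣≤1/[1+d] b≥1 a≤b (d<P n d) (N-invariant n {a} {b} proportional d))

corollary1 : (q ε : ℕ → ℕ) →
    (∀ k → 1 ≤ k → 1 < q k) →
    (∀ k → 1 ≤ k → ε k < q k) →
    (n₀ : ℕ) → 1 ≤ n₀ →
    (q₀ : ℕ) → (∀ n → n₀ < n → q₀ ≤ q n) →
    (k : ℕ) → 1 ≤ k → q (n₀ + k) ≡ q₀ →
    (ε₀ : ℕ) → ε (n₀ + k) ≡ ε₀ →
    ((∀ n m → n₀ ≤ n → n₀ ≤ m → SigmaEq q ε n m)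
      ⇔ (∀ n → n₀ < n → (q₀ ∸ 1) * ε n ≡ (q n ∸ 1) * ε₀))
-- Neither n₀ ≥ 1 nor the minimality of q₀ is needed: any index n₀ + k > n₀ serves as reference.
corollary1 q ε q>1 ε<q n₀ _ q₀ _ k k≥1 q[n₀+k]≡q₀ ε₀ ε[n₀+k]≡ε₀ = mk⇔ proportional tailsEqual
  where
  open Expansion q ε q>1 ε<q

  n₀<n₀+k : n₀ < n₀ + k
  n₀<n₀+k = ℕ.m<m+n n₀ k≥1

  proportional : (∀ n m → n₀ ≤ n → n₀ ≤ m → SigmaEq q ε n m) →
                 ∀ n → n₀ < n → (q₀ ∸ 1) * ε n ≡ (q n ∸ 1) * ε₀
  proportional σ-equal n n₀<n =
    ∼-proportional {σ (n₀ + k)} (ε n) ε₀ (q n ∸ 1) (q₀ ∸ 1) (digit n n₀<n)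
      (subst₂ (λ e c → const (fromℕ e) ∼ (c ∸ 1) ·ₛ σ (n₀ + k)) ε[n₀+k]≡ε₀ q[n₀+k]≡q₀
        (digit (n₀ + k) n₀<n₀+k))
    where
    σ∼σ : ∀ n m → n₀ ≤ n → n₀ ≤ m → σ n ∼ σ m
    σ∼σ n m n₀≤n n₀≤m = mk∼ (σ-equal n m n₀≤n n₀≤m)
    digit : ∀ n → n₀ < n → const (fromℕ (ε n)) ∼ (q n ∸ 1) ·ₛ σ (n₀ + k)
    digit (suc p) (s≤s n₀≤p) = ∼-trans
      (ε∼[q-1]σ p (σ∼σ p (suc p) n₀≤p n₀≤1+p))
      (∼-scale (q (suc p) ∸ 1) (σ∼σ (suc p) (n₀ + k) n₀≤1+p (ℕ.m≤m+n n₀ k)))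
      where
      n₀≤1+p : n₀ ≤ suc p
      n₀≤1+p = ℕ.m≤n⇒m≤1+n n₀≤p

  tailsEqual : (∀ n → n₀ < n → (q₀ ∸ 1) * ε n ≡ (q n ∸ 1) * ε₀) →
               ∀ n m → n₀ ≤ n → n₀ ≤ m → SigmaEq q ε n m
  tailsEqual proportional n m n₀≤n n₀≤m =
    eventually-close (∼-trans (σ∼ε₀/[q₀-1] n n₀≤n) (∼-sym (σ∼ε₀/[q₀-1] m n₀≤m)))
    where
    1≤n₀+k : 1 ≤ n₀ + k
    1≤n₀+k = ℕ.≤-trans (s≤s z≤n) n₀<n₀+k
    1≤q₀∸1 : 1 ≤ q₀ ∸ 1
    1≤q₀∸1 = ℕ.∸-monoˡ-≤ 1 (subst (1 <_) q[n₀+k]≡q₀ (q>1 (n₀ + k) 1≤n₀+k))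
    ε₀≤q₀∸1 : ε₀ ≤ q₀ ∸ 1
    ε₀≤q₀∸1 =
      ℕ.∸-monoˡ-≤ 1 (subst₂ _<_ ε[n₀+k]≡ε₀ q[n₀+k]≡q₀ (ε<q (n₀ + k) 1≤n₀+k))
    σ∼ε₀/[q₀-1] : ∀ n → n₀ ≤ n → σ n ∼ const (frac ε₀ (q₀ ∸ 1))
    σ∼ε₀/[q₀-1] n n₀≤n =
      σ∼a/b n 1≤q₀∸1 ε₀≤q₀∸1 (λ i n<i → proportional i (ℕ.≤-<-trans n₀≤n n<i))
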